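{- The hyperbolicity $\delta(G)$ of every $n$-vertex Helly graph $G$ satisfies $\delta(G)\le \sqrt{n}+1$.
   Context: Graphs are finite, connected, undirected and unweighted with shortest-path distance $d$. A graph is Helly if every family of pairwise intersecting balls $N^r[v]=\{u: d(u,v)\le r\}$ has a nonempty common intersection. $\delta(G)$ is the smallest half-integer $\delta\ge0$ such that for any four vertices $u,v,w,x$, the two largest of $d(u,v)+d(w,x)$, $d(u,w)+d(v,x)$, $d(u,x)+d(v,w)$ differ by at most $2\delta$. -}

module Defs where

open import Data.Nat using (ℕ; zero; suc; _+_; _*_; _∸_; _≤_; _⊔_; _⊓_)
open import Data.Fin using (Fin)
open import Data.Product using (Σ; _×_; ∃; ∃-syntax; _,_)
open import Data.List using (List)
open import Data.List.Membership.Propositional using (_∈_)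
open import Relation.Binary.PropositionalEquality using (_≡_)
open import Relation.Nullary using (¬_)

record Graph (n : ℕ) : Set₁ where
  field
    Adj      : Fin n → Fin n → Set
    Adj-sym  : ∀ {u v} → Adj u v → Adj v u
    Adj-irr  : ∀ {u} → ¬ Adj u u
open Graph public

data Walk {n : ℕ} (G : Graph n) : Fin n → Fin n → ℕ → Set where
  nil  : ∀ {u} → Walk G u u 0
  cons : ∀ {u w v k} → Adj G u w → Walk G w v k → Walk G u v (suc k)

Connected : ∀ {n} → Graph n → Set
Connected G = ∀ u v → ∃[ k ] Walk G u v k

Dist : ∀ {n} → Graph n → Fin n → Fin n → ℕ → Set
Dist G u v k = Walk G u v k × (∀ m → Walk G u v m → k ≤ m)

InBall : ∀ {n} → Graph n → Fin n → ℕ → Fin n → Set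
InBall G v r u = ∃[ k ] (Dist G u v k × k ≤ r)

Helly : ∀ {n} → Graph n → Set
Helly {n} G = (F : List (Fin n × ℕ)) →
  (∀ {v r v' r'} → (v , r) ∈ F → (v' , r') ∈ F →
     ∃[ u ] (InBall G v r u × InBall G v' r' u)) →
  ∃[ u ] (∀ {v r} → (v , r) ∈ F → InBall G v r u)

-- Difference between the largest and the second largest of a, b, c
-- (the second largest is the median (a⊓b)⊔(b⊓c)⊔(a⊓c)).
gap : ℕ → ℕ → ℕ → ℕ
gap a b c = (a ⊔ b ⊔ c) ∸ ((a ⊓ b) ⊔ (b ⊓ c) ⊔ (a ⊓ c))

-- Four-point condition with bound t = 2δ.
FourPoint : ∀ {n} → Graph n → ℕ → Set
FourPoint G t = ∀ u v w x (duv dwx duw dvx dux dvw : ℕ) →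
  Dist G u v duv → Dist G w x dwx →
  Dist G u w duw → Dist G v x dvx →
  Dist G u x dux → Dist G v w dvw →
  gap (duv + dwx) (duw + dvx) (dux + dvw) ≤ t

-- IsHyperbolicity G t : δ(G) = t/2, i.e. t = 2δ(G) is the least natural
-- number for which the four-point condition holds (δ ranges over half-integers).
IsHyperbolicity : ∀ {n} → Graph n → ℕ → Set
IsHyperbolicity G t = FourPoint G t × (∀ m → FourPoint G m → t ≤ m)

-- Let u, v, w, x realise the gap g = 2δ, with d(u,v) + d(w,x) the largest of
-- the three distance sums. For every pair p, q < ⌊g/2⌋ one can choose radii
-- i + i′ = d(u,v) and j + j′ = d(w,x), with (i + j, i − j) running over a
-- square grid of side ⌊g/2⌋, such that the four balls N^i[u], N^i′[v],
-- N^j[w], N^j′[x] pairwise intersect. By the Helly property they share a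
-- vertex z, which then lies at distance exactly i from u and j from w.
-- Distinct grid points therefore give distinct vertices, so ⌊g/2⌋² ≤ n,
-- i.e. (g − 2)² ≤ 4n.
module Submission where

open import Defs
open import Level using (0ℓ)
open import Function using (_∘_)
open import Data.Nat using (ℕ; zero; suc; _+_; _*_; _∸_; _≤_; _<_; _⊔_; _⊓_; ⌊_/2⌋; ⌈_/2⌉; z≤n)
open import Data.Nat.Properties
open import Data.Nat.Tactic.RingSolver using (solve; solve-∀)
open import Data.Fin using (Fin; toℕ; combine; remQuot)
open import Data.Fin.Properties using (toℕ<n; toℕ-injective; combine-remQuot; injective⇒≤)
open import Data.Product using (_×_; ∃₂; ∃-syntax; _,_; proj₁; uncurry; map)
open import Data.Sum using (_⊎_; inj₁; inj₂)
open import Data.List using ([]; _∷_)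
open import Data.List.Membership.Propositional using (_∈_)
open import Data.List.Relation.Unary.Any using (here; there)
open import Data.List.Relation.Unary.All as All using ()
open import Data.List.Relation.Unary.AllPairs using (AllPairs)
open import Relation.Binary.Core using (Rel)
open import Relation.Binary.Definitions using (Reflexive; Symmetric)
open import Relation.Binary.PropositionalEquality
open import Relation.Nullary using (yes; no; contradiction)

-- The constructors of All and AllPairs are opened only locally: an overloaded
-- _∷_ makes the variable lists given to solve ambiguous.
module _ where
  open import Data.List.Relation.Unary.AllPairs using (_∷_)

  allPairs⇒related : ∀ {a ℓ} {A : Set a} {R : Rel A ℓ} → Reflexive R → Symmetric R →
    ∀ {xs x y} → AllPairs R xs → x ∈ xs → y ∈ xs → R x y
  allPairs⇒related R-refl R-sym (_ ∷ _)   (here refl) (here refl) = R-refl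
  allPairs⇒related R-refl R-sym (Rx ∷ _)  (here refl) (there y∈)  = All.lookup Rx y∈
  allPairs⇒related R-refl R-sym (Rx ∷ _)  (there x∈)  (here refl) = R-sym (All.lookup Rx x∈)
  allPairs⇒related R-refl R-sym (_ ∷ Rxs) (there x∈)  (there y∈)  =
    allPairs⇒related R-refl R-sym Rxs x∈ y∈

pairs-injection⇒≤ : ∀ {m k n} (f : Fin m → Fin k → Fin n) →
  (∀ {p q p′ q′} → f p q ≡ f p′ q′ → p ≡ p′ × q ≡ q′) → m * k ≤ n
pairs-injection⇒≤ {m} {k} f f-injective = injective⇒≤ {f = uncurry f ∘ remQuot {m} k} injective
  where
  injective : ∀ {l l′} → uncurry f (remQuot {m} k l) ≡ uncurry f (remQuot {m} k l′) → l ≡ l′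
  injective {l} {l′} e with f-injective e
  ... | p≡p′ , q≡q′ = begin
    l                                  ≡⟨ combine-remQuot {m} k l ⟨
    uncurry combine (remQuot {m} k l)  ≡⟨ cong (uncurry combine) (cong₂ _,_ p≡p′ q≡q′) ⟩
    uncurry combine (remQuot {m} k l′) ≡⟨ combine-remQuot {m} k l′ ⟩
    l′                                 ∎
    where open ≡-Reasoning

m+m≤n+n⇒m≤n : ∀ {m n} → m + m ≤ n + n → m ≤ n
m+m≤n+n⇒m≤n {m} {n} le = subst₂ _≤_ (sym (n≡⌊n+n/2⌋ m)) (sym (n≡⌊n+n/2⌋ n)) (⌊n/2⌋-mono le)

m+m≡n+n⇒m≡n : ∀ {m n} → m + m ≡ n + n → m ≡ n
m+m≡n+n⇒m≡n {m} {n} e = trans (n≡⌊n+n/2⌋ m) (trans (cong ⌊_/2⌋ e) (sym (n≡⌊n+n/2⌋ n)))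

⌊n/2⌋+⌊n/2⌋≤n : ∀ n → ⌊ n /2⌋ + ⌊ n /2⌋ ≤ n
⌊n/2⌋+⌊n/2⌋≤n n = ≤-trans (+-monoʳ-≤ ⌊ n /2⌋ (⌊n/2⌋≤⌈n/2⌉ n)) (≤-reflexive (⌊n/2⌋+⌈n/2⌉≡n n))

⌈n/2⌉≤1+⌊n/2⌋ : ∀ n → ⌈ n /2⌉ ≤ suc ⌊ n /2⌋
⌈n/2⌉≤1+⌊n/2⌋ n = ⌊n/2⌋-mono (n≤1+n (suc n))

n∸2≤⌊n/2⌋+⌊n/2⌋ : ∀ n → n ∸ 2 ≤ ⌊ n /2⌋ + ⌊ n /2⌋
n∸2≤⌊n/2⌋+⌊n/2⌋ n = begin
  n ∸ 2                     ≤⟨ ∸-monoˡ-≤ 2 (≤-reflexive (sym (⌊n/2⌋+⌈n/2⌉≡n n))) ⟩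
  ⌊ n /2⌋ + ⌈ n /2⌉ ∸ 2     ≤⟨ ∸-monoˡ-≤ 2 (+-monoʳ-≤ ⌊ n /2⌋ (⌈n/2⌉≤1+⌊n/2⌋ n)) ⟩
  ⌊ n /2⌋ + suc ⌊ n /2⌋ ∸ 2 ≤⟨ ∸-monoˡ-≤ 2 (≤-reflexive (+-suc ⌊ n /2⌋ ⌊ n /2⌋)) ⟩
  ⌊ n /2⌋ + ⌊ n /2⌋ ∸ 1     ≤⟨ m∸n≤m _ 1 ⟩
  ⌊ n /2⌋ + ⌊ n /2⌋         ∎
  where open ≤-Reasoning

median : ℕ → ℕ → ℕ → ℕ
median a b c = (a ⊓ b) ⊔ (b ⊓ c) ⊔ (a ⊓ c)

module _ (a b c : ℕ) where

  a⊓b≤median : a ⊓ b ≤ median a b c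
  a⊓b≤median = ≤-trans (m≤m⊔n (a ⊓ b) (b ⊓ c)) (m≤m⊔n _ (a ⊓ c))

  b⊓c≤median : b ⊓ c ≤ median a b c
  b⊓c≤median = ≤-trans (m≤n⊔m (a ⊓ b) (b ⊓ c)) (m≤m⊔n _ (a ⊓ c))

  a⊓c≤median : a ⊓ c ≤ median a b c
  a⊓c≤median = m≤n⊔m _ (a ⊓ c)

  median≤max : median a b c ≤ a ⊔ b ⊔ c
  median≤max = ⊔-lub (⊔-lub (≤-trans (m⊓n≤m a b) a≤max) (≤-trans (m⊓n≤m b c) b≤max))
                     (≤-trans (m⊓n≤m a c) a≤max)
    where
    a≤max : a ≤ a ⊔ b ⊔ c
    a≤max = ≤-trans (m≤m⊔n a b) (m≤m⊔n _ c)
    b≤max : b ≤ a ⊔ b ⊔ c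
    b≤max = ≤-trans (m≤n⊔m a b) (m≤m⊔n _ c)

  ≤median⇒+gap≤max : ∀ {y} → y ≤ median a b c → y + gap a b c ≤ a ⊔ b ⊔ c
  ≤median⇒+gap≤max {y} y≤median = begin
    y + gap a b c                                ≤⟨ +-monoˡ-≤ (gap a b c) y≤median ⟩
    median a b c + (a ⊔ b ⊔ c ∸ median a b c)    ≡⟨ m+[n∸m]≡n median≤max ⟩
    a ⊔ b ⊔ c                                    ∎
    where open ≤-Reasoning

  gap-below-max : ∀ {y z M} → a ⊔ b ⊔ c ≡ M → y ≤ median a b c → z ≤ median a b c →
    y + gap a b c ≤ M × z + gap a b c ≤ M
  gap-below-max refl y≤median z≤median = ≤median⇒+gap≤max y≤median , ≤median⇒+gap≤max z≤median

  c-largest : a ≤ c → b ≤ c → a + gap a b c ≤ c × b + gap a b c ≤ c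
  c-largest a≤c b≤c = gap-below-max (m≤n⇒m⊔n≡n (⊔-lub a≤c b≤c))
    (subst (_≤ median a b c) (m≤n⇒m⊓n≡m a≤c) a⊓c≤median)
    (subst (_≤ median a b c) (m≤n⇒m⊓n≡m b≤c) b⊓c≤median)

  gap-cases : (b + gap a b c ≤ a × c + gap a b c ≤ a)
            ⊎ (a + gap a b c ≤ b × c + gap a b c ≤ b)
            ⊎ (a + gap a b c ≤ c × b + gap a b c ≤ c)
  gap-cases with ≤-total b a
  gap-cases | inj₁ b≤a with ≤-total c a
  ... | inj₁ c≤a = inj₁ (gap-below-max
          (trans (cong (_⊔ c) (m≥n⇒m⊔n≡m b≤a)) (m≥n⇒m⊔n≡m c≤a))
          (subst (_≤ median a b c) (m≥n⇒m⊓n≡n b≤a) a⊓b≤median)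
          (subst (_≤ median a b c) (m≥n⇒m⊓n≡n c≤a) a⊓c≤median))
  ... | inj₂ a≤c = inj₂ (inj₂ (c-largest a≤c (≤-trans b≤a a≤c)))
  gap-cases | inj₂ a≤b with ≤-total c b
  ... | inj₁ c≤b = inj₂ (inj₁ (gap-below-max
          (trans (cong (_⊔ c) (m≤n⇒m⊔n≡n a≤b)) (m≥n⇒m⊔n≡m c≤b))
          (subst (_≤ median a b c) (m≤n⇒m⊓n≡m a≤b) a⊓b≤median)
          (subst (_≤ median a b c) (m≥n⇒m⊓n≡n c≤b) b⊓c≤median)))
  ... | inj₂ b≤c = inj₂ (inj₂ (c-largest (≤-trans a≤b b≤c) b≤c))

radii-bounded : ∀ {a b dux dvw dvx i j} → b ≤ dvw + dvx → a ≤ dux + dvx →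
  dux + j ≤ i + b → dvw + i ≤ a + j → dvx + (i + j) ≤ a + b → i ≤ a × j ≤ b
radii-bounded {a} {b} {dux} {dvw} {dvx} {i} {j} b≤dvw+dvx a≤dux+dvx c₂ c₃ c₄ =
  m+m≤n+n⇒m≤n (+-cancelʳ-≤ (dvw + dvx + j) (i + i) (a + a) (begin
    (i + i) + (dvw + dvx + j)   ≡⟨ solve (i ∷ j ∷ dvw ∷ dvx ∷ []) ⟩
    (dvw + i) + (dvx + (i + j)) ≤⟨ +-mono-≤ c₃ c₄ ⟩
    (a + j) + (a + b)           ≡⟨ solve (a ∷ b ∷ j ∷ []) ⟩
    (a + a) + (b + j)           ≤⟨ +-monoʳ-≤ (a + a) (+-monoˡ-≤ j b≤dvw+dvx) ⟩
    (a + a) + (dvw + dvx + j)   ∎)) ,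
  m+m≤n+n⇒m≤n (+-cancelʳ-≤ (dux + dvx + i) (j + j) (b + b) (begin
    (j + j) + (dux + dvx + i)   ≡⟨ solve (i ∷ j ∷ dux ∷ dvx ∷ []) ⟩
    (dux + j) + (dvx + (i + j)) ≤⟨ +-mono-≤ c₂ c₄ ⟩
    (i + b) + (a + b)           ≡⟨ solve (a ∷ b ∷ i ∷ []) ⟩
    (b + b) + (a + i)           ≤⟨ +-monoʳ-≤ (b + b) (+-monoˡ-≤ i a≤dux+dvx) ⟩
    (b + b) + (dux + dvx + i)   ∎))
  where open ≤-Reasoning

ball-radii : ∀ {a b dux dvw dvx i j} → b ≤ dvw + dvx → a ≤ dux + dvx →
  dux + j ≤ i + b → dvw + i ≤ a + j → dvx + (i + j) ≤ a + b →
  ∃₂ λ i′ j′ → i + i′ ≡ a × j + j′ ≡ b × dux ≤ i + j′ × dvw ≤ i′ + j × dvx ≤ i′ + j′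
ball-radii {dux = dux} {dvw} {dvx} {i} {j} b≤dvw+dvx a≤dux+dvx c₂ c₃ c₄
  with i≤a , j≤b ← radii-bounded b≤dvw+dvx a≤dux+dvx c₂ c₃ c₄
  with i′ , refl ← m≤n⇒∃[o]m+o≡n i≤a
  with j′ , refl ← m≤n⇒∃[o]m+o≡n j≤b
  = i′ , j′ , refl , refl
  , +-cancelʳ-≤ j dux (i + j′) (≤-trans c₂ (≤-reflexive (solve (i ∷ j ∷ j′ ∷ []))))
  , +-cancelʳ-≤ i dvw (i′ + j) (≤-trans c₃ (≤-reflexive (solve (i ∷ i′ ∷ j ∷ []))))
  , +-cancelʳ-≤ (i + j) dvx (i′ + j′) (≤-trans c₄ (≤-reflexive (solve (i ∷ i′ ∷ j ∷ j′ ∷ []))))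

module RadiusGrid {a b duw dux dvw dvx g : ℕ}
  (b≤duw+dux : b ≤ duw + dux) (dux≤duw+b : dux ≤ duw + b) (a≤duw+dvw : a ≤ duw + dvw)
  (b≤dvw+dvx : b ≤ dvw + dvx) (a≤dux+dvx : a ≤ dux + dvx)
  (gap-uw : duw + dvx + g ≤ a + b) (gap-ux : dux + dvw + g ≤ a + b) where

  m : ℕ
  m = ⌊ g /2⌋

  -- The grid point (p, q) has i = i₀ + p + q and j = j₀ + p − q, so that
  -- i − j = dux − b + 2q and i + j = duw + r + 2p with r = i₀ + j₀ − duw ∈ {0, 1};
  -- r fixes the parity of i + j to that of i − j, hence i₀ = ⌈T/2⌉.
  private
    T : ℕ
    T = duw + dux ∸ b

    h : ℕ
    h = ⌊ T /2⌋

  i₀ : ℕ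
  i₀ = ⌈ T /2⌉

  j₀ : ℕ
  j₀ = duw ∸ h

  h≤duw : h ≤ duw
  h≤duw = m+m≤n+n⇒m≤n (+-cancelˡ-≤ b (h + h) (duw + duw) (begin
    b + (h + h)     ≤⟨ +-monoʳ-≤ b (⌊n/2⌋+⌊n/2⌋≤n T) ⟩
    b + T           ≡⟨ m+[n∸m]≡n b≤duw+dux ⟩
    duw + dux       ≤⟨ +-monoʳ-≤ duw dux≤duw+b ⟩
    duw + (duw + b) ≡⟨ solve (b ∷ duw ∷ []) ⟩
    b + (duw + duw) ∎))
    where open ≤-Reasoning

  h+j₀≡duw : h + j₀ ≡ duw
  h+j₀≡duw = m+[n∸m]≡n h≤duw

  origin-offset : i₀ + b ≡ j₀ + dux
  origin-offset = +-cancelˡ-≡ h (i₀ + b) (j₀ + dux) (begin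
    h + (i₀ + b)   ≡⟨ +-assoc h i₀ b ⟨
    h + i₀ + b     ≡⟨ cong (_+ b) (⌊n/2⌋+⌈n/2⌉≡n T) ⟩
    T + b          ≡⟨ +-comm T b ⟩
    b + T          ≡⟨ m+[n∸m]≡n b≤duw+dux ⟩
    duw + dux      ≡⟨ cong (_+ dux) h+j₀≡duw ⟨
    h + j₀ + dux   ≡⟨ +-assoc h j₀ dux ⟩
    h + (j₀ + dux) ∎)
    where open ≡-Reasoning

  duw≤i₀+j₀ : duw ≤ i₀ + j₀
  duw≤i₀+j₀ = subst (_≤ i₀ + j₀) h+j₀≡duw (+-monoˡ-≤ j₀ (⌊n/2⌋≤⌈n/2⌉ T))

  i₀+j₀≤1+duw : i₀ + j₀ ≤ suc duw
  i₀+j₀≤1+duw = subst (i₀ + j₀ ≤_) (cong suc h+j₀≡duw) (+-monoˡ-≤ j₀ (⌈n/2⌉≤1+⌊n/2⌋ T))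

  m≤j₀ : m ≤ j₀
  m≤j₀ = m+m≤n+n⇒m≤n (+-cancelʳ-≤ (dux + dvw) (m + m) (j₀ + j₀) (begin
    m + m + (dux + dvw)     ≤⟨ +-monoˡ-≤ (dux + dvw) (⌊n/2⌋+⌊n/2⌋≤n g) ⟩
    g + (dux + dvw)         ≡⟨ +-comm g (dux + dvw) ⟩
    dux + dvw + g           ≤⟨ gap-ux ⟩
    a + b                   ≤⟨ +-monoˡ-≤ b a≤duw+dvw ⟩
    duw + dvw + b           ≤⟨ +-monoˡ-≤ b (+-monoˡ-≤ dvw duw≤i₀+j₀) ⟩
    i₀ + j₀ + dvw + b       ≡⟨ shuffle i₀ j₀ dvw b ⟩
    j₀ + dvw + (i₀ + b)     ≡⟨ cong (j₀ + dvw +_) origin-offset ⟩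
    j₀ + dvw + (j₀ + dux)   ≡⟨ regroup j₀ dvw dux ⟩
    j₀ + j₀ + (dux + dvw)   ∎))
    where
    open ≤-Reasoning
    shuffle : ∀ x y z w → x + y + z + w ≡ y + z + (x + w)
    shuffle = solve-∀
    regroup : ∀ x y z → x + y + (x + z) ≡ x + x + (z + y)
    regroup = solve-∀

  uRadius : ℕ → ℕ → ℕ
  uRadius p q = i₀ + p + q

  wRadius : ℕ → ℕ → ℕ
  wRadius p q = j₀ + p ∸ q

  wRadius+q : ∀ p {q} → q < m → wRadius p q + q ≡ j₀ + p
  wRadius+q p q<m = m∸n+n≡m (≤-trans (<⇒≤ q<m) (≤-trans m≤j₀ (m≤m+n j₀ p)))

  radii-sum : ∀ p {q} → q < m → uRadius p q + wRadius p q ≡ i₀ + j₀ + (p + p)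
  radii-sum p {q} q<m = +-cancelʳ-≡ q _ _ (begin
    i₀ + p + q + wRadius p q + q    ≡⟨ +-assoc (i₀ + p + q) (wRadius p q) q ⟩
    i₀ + p + q + (wRadius p q + q)  ≡⟨ cong (i₀ + p + q +_) (wRadius+q p q<m) ⟩
    i₀ + p + q + (j₀ + p)           ≡⟨ regroup i₀ j₀ p q ⟩
    i₀ + j₀ + (p + p) + q           ∎)
    where
    open ≡-Reasoning
    regroup : ∀ x y z w → x + z + w + (y + z) ≡ x + y + (z + z) + w
    regroup = solve-∀

  radii-offset : ∀ p {q} → q < m → uRadius p q + b ≡ dux + wRadius p q + (q + q)
  radii-offset p {q} q<m = begin
    i₀ + p + q + b                ≡⟨ regroup₀ i₀ p q b ⟩
    i₀ + b + (p + q)              ≡⟨ cong (_+ (p + q)) origin-offset ⟩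
    j₀ + dux + (p + q)            ≡⟨ regroup₁ j₀ dux p q ⟩
    dux + (j₀ + p) + q            ≡⟨ cong (λ s → dux + s + q) (wRadius+q p q<m) ⟨
    dux + (wRadius p q + q) + q   ≡⟨ regroup₂ dux (wRadius p q) q ⟩
    dux + wRadius p q + (q + q)   ∎
    where
    open ≡-Reasoning
    regroup₀ : ∀ x y z w → x + y + z + w ≡ x + w + (y + z)
    regroup₀ = solve-∀
    regroup₁ : ∀ x y z w → x + y + (z + w) ≡ y + (x + z) + w
    regroup₁ = solve-∀
    regroup₂ : ∀ x y z → x + (y + z) + z ≡ x + y + (z + z)
    regroup₂ = solve-∀

  grid-diagonal : ∀ {p q} → q < m → duw ≤ uRadius p q + wRadius p q
  grid-diagonal {p} q<m =
    subst (duw ≤_) (sym (radii-sum p q<m)) (≤-trans duw≤i₀+j₀ (m≤m+n (i₀ + j₀) (p + p)))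

  grid-radii : ∀ {p q} → p < m → q < m →
    ∃₂ λ i′ j′ → uRadius p q + i′ ≡ a × wRadius p q + j′ ≡ b ×
      dux ≤ uRadius p q + j′ × dvw ≤ i′ + wRadius p q × dvx ≤ i′ + j′
  grid-radii {p} {q} p<m q<m = ball-radii b≤dvw+dvx a≤dux+dvx
    (≤-trans (m≤m+n _ (q + q)) (≤-reflexive (sym (radii-offset p q<m))))
    (+-cancelʳ-≤ b (dvw + i) (a + j) (begin
      dvw + i + b                 ≡⟨ +-assoc dvw i b ⟩
      dvw + (i + b)               ≡⟨ cong (dvw +_) (radii-offset p q<m) ⟩
      dvw + (dux + j + (q + q))   ≡⟨ regroup₁ dvw dux j (q + q) ⟩
      dux + dvw + (q + q) + j     ≤⟨ +-monoˡ-≤ j (+-monoʳ-≤ (dux + dvw) 2q≤g) ⟩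
      dux + dvw + g + j           ≤⟨ +-monoˡ-≤ j gap-ux ⟩
      a + b + j                   ≡⟨ swap-last a b j ⟩
      a + j + b                   ∎))
    (begin
      dvx + (i + j)               ≡⟨ cong (dvx +_) (radii-sum p q<m) ⟩
      dvx + (i₀ + j₀ + (p + p))   ≤⟨ +-monoʳ-≤ dvx (+-monoˡ-≤ (p + p) i₀+j₀≤1+duw) ⟩
      dvx + (suc duw + (p + p))   ≡⟨ solve (dvx ∷ duw ∷ p ∷ []) ⟩
      duw + dvx + suc (p + p)     ≤⟨ +-monoʳ-≤ (duw + dvx) 1+2p≤g ⟩
      duw + dvx + g               ≤⟨ gap-uw ⟩
      a + b                       ∎)
    where
    open ≤-Reasoning
    regroup₁ : ∀ x y z w → x + (y + z + w) ≡ y + x + w + z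
    regroup₁ = solve-∀
    swap-last : ∀ x y z → x + y + z ≡ x + z + y
    swap-last = solve-∀
    i j : ℕ
    i = uRadius p q
    j = wRadius p q
    2q≤g : q + q ≤ g
    2q≤g = ≤-trans (+-mono-≤ (<⇒≤ q<m) (<⇒≤ q<m)) (⌊n/2⌋+⌊n/2⌋≤n g)
    1+2p≤g : suc (p + p) ≤ g
    1+2p≤g = ≤-trans (+-mono-≤ p<m (<⇒≤ p<m)) (⌊n/2⌋+⌊n/2⌋≤n g)

  radii-injective : ∀ {p q p′ q′} → q < m → q′ < m →
    uRadius p q ≡ uRadius p′ q′ → wRadius p q ≡ wRadius p′ q′ → p ≡ p′ × q ≡ q′
  radii-injective {p} {q} {p′} {q′} q<m q′<m eᵤ eʷ =
    p≡p′ , +-cancelˡ-≡ (i₀ + p) q q′ (trans eᵤ (cong (λ s → i₀ + s + q′) (sym p≡p′)))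
    where
    p≡p′ : p ≡ p′
    p≡p′ = m+m≡n+n⇒m≡n (+-cancelˡ-≡ (i₀ + j₀) (p + p) (p′ + p′)
      (trans (sym (radii-sum p q<m)) (trans (cong₂ _+_ eᵤ eʷ) (radii-sum p′ q′<m))))

module _ {n : ℕ} {G : Graph n} where

  infixr 5 _++ʷ_
  _++ʷ_ : ∀ {u v w k l} → Walk G u v k → Walk G v w l → Walk G u w (k + l)
  nil      ++ʷ q = q
  cons e p ++ʷ q = cons e (p ++ʷ q)

  reverseʷ : ∀ {u v k} → Walk G u v k → Walk G v u k
  reverseʷ nil = nil
  reverseʷ {k = suc k} (cons e p) =
    subst (Walk G _ _) (+-comm k 1) (reverseʷ p ++ʷ cons (Adj-sym G e) nil)

  splitAtʷ : ∀ {u v} k {l} → Walk G u v (k + l) → ∃[ y ] (Walk G u y k × Walk G y v l)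
  splitAtʷ zero    p          = _ , nil , p
  splitAtʷ (suc k) (cons e p) with y , p₁ , p₂ ← splitAtʷ k p = y , cons e p₁ , p₂

  Dist-refl : ∀ {u} → Dist G u u 0
  Dist-refl = nil , λ _ _ → z≤n

  Dist-sym : ∀ {u v k} → Dist G u v k → Dist G v u k
  Dist-sym (p , shortest) = reverseʷ p , λ l q → shortest l (reverseʷ q)

  Dist-unique : ∀ {u v k l} → Dist G u v k → Dist G u v l → k ≡ l
  Dist-unique (p , shortest) (q , shortest′) = ≤-antisym (shortest _ q) (shortest′ _ p)

  Dist-triangle : ∀ {u v w k l d} → Dist G u v k → Dist G v w l → Dist G u w d → d ≤ k + l
  Dist-triangle (p , _) (q , _) (_ , shortest) = shortest _ (p ++ʷ q)

  Dist-prefix : ∀ {u v y k l} → Dist G u v (k + l) → Walk G u y k → Walk G y v l → Dist G u y k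
  Dist-prefix {k = k} {l} (_ , shortest) p q =
    p , λ k′ p′ → +-cancelʳ-≤ l k k′ (shortest (k′ + l) (p′ ++ʷ q))

  Dist-suffix : ∀ {u v y k l} → Dist G u v (k + l) → Walk G u y k → Walk G y v l → Dist G y v l
  Dist-suffix {k = k} {l} (_ , shortest) p q =
    q , λ l′ q′ → +-cancelˡ-≤ k l l′ (shortest (k + l′) (p ++ʷ q′))

  Meets : Rel (Fin n × ℕ) 0ℓ
  Meets (v , r) (v′ , r′) = ∃[ y ] (InBall G v r y × InBall G v′ r′ y)

  Meets-refl : Reflexive Meets
  Meets-refl {v , r} = v , (0 , Dist-refl , z≤n) , (0 , Dist-refl , z≤n)

  Meets-sym : Symmetric Meets
  Meets-sym (y , y∈ , y∈′) = y , y∈′ , y∈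

  Dist⇒Meets : ∀ {v v′ d} r r′ → Dist G v v′ d → d ≤ r + r′ → Meets (v , r) (v′ , r′)
  Dist⇒Meets {v} {v′} {d} r r′ dvv′ d≤r+r′ with d ≤? r
  ... | yes d≤r = v′ , (d , Dist-sym dvv′ , d≤r) , (0 , Dist-refl , z≤n)
  ... | no d≰r with l , refl ← m≤n⇒∃[o]m+o≡n (<⇒≤ (≰⇒> d≰r))
               with y , p , q ← splitAtʷ r (proj₁ dvv′) =
    y , (r , Dist-sym (Dist-prefix dvv′ p q) , ≤-refl)
      , (l , Dist-suffix dvv′ p q , +-cancelˡ-≤ r l r′ d≤r+r′)

  InBall-geodesic : ∀ {u v z i i′} → Dist G u v (i + i′) →
    InBall G u i z → InBall G v i′ z → Dist G z u i
  InBall-geodesic {i = i} {i′} uv (k , dzu , k≤i) (k′ , dzv , k′≤i′) =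
    subst (Dist G _ _) (≤-antisym k≤i i≤k) dzu
    where
    i≤k : i ≤ k
    i≤k = +-cancelʳ-≤ i′ i k (≤-trans (Dist-triangle (Dist-sym dzu) dzv uv) (+-monoʳ-≤ k k′≤i′))

  open import Data.List.Relation.Unary.All using ([]; _∷_)
  open import Data.List.Relation.Unary.AllPairs using ([]; _∷_)

  pairwise-meeting : ∀ {u v w x i i′ j j′ duw dux dvw dvx} →
    Dist G u v (i + i′) → Dist G w x (j + j′) →
    Dist G u w duw → duw ≤ i + j → Dist G u x dux → dux ≤ i + j′ →
    Dist G v w dvw → dvw ≤ i′ + j → Dist G v x dvx → dvx ≤ i′ + j′ →
    AllPairs Meets ((u , i) ∷ (v , i′) ∷ (w , j) ∷ (x , j′) ∷ [])
  pairwise-meeting {i = i} {i′} {j} {j′} uv wx uw c₁ ux c₂ vw c₃ vx c₄ =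
    (Dist⇒Meets i i′ uv ≤-refl ∷ Dist⇒Meets i j uw c₁ ∷ Dist⇒Meets i j′ ux c₂ ∷ []) ∷
    (Dist⇒Meets i′ j vw c₃ ∷ Dist⇒Meets i′ j′ vx c₄ ∷ []) ∷
    (Dist⇒Meets j j′ wx ≤-refl ∷ []) ∷
    [] ∷
    []

  helly-four-balls : Helly G → ∀ {u v w x i i′ j j′ duw dux dvw dvx} →
    Dist G u v (i + i′) → Dist G w x (j + j′) →
    Dist G u w duw → duw ≤ i + j → Dist G u x dux → dux ≤ i + j′ →
    Dist G v w dvw → dvw ≤ i′ + j → Dist G v x dvx → dvx ≤ i′ + j′ →
    ∃[ z ] (Dist G z u i × Dist G z w j)
  helly-four-balls helly uv wx uw c₁ ux c₂ vw c₃ vx c₄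
    with z , z∈ ← helly _ (allPairs⇒related Meets-refl Meets-sym
                            (pairwise-meeting uv wx uw c₁ ux c₂ vw c₃ vx c₄)) =
    z , InBall-geodesic uv (z∈ (here refl)) (z∈ (there (here refl)))
      , InBall-geodesic wx (z∈ (there (there (here refl)))) (z∈ (there (there (there (here refl)))))

module _ {n : ℕ} {G : Graph n} (helly : Helly G) where

  helly-grid-size : ∀ {u v w x a b duw dux dvw dvx g} →
    Dist G u v a → Dist G w x b → Dist G u w duw → Dist G u x dux → Dist G v w dvw → Dist G v x dvx →
    duw + dvx + g ≤ a + b → dux + dvw + g ≤ a + b → ⌊ g /2⌋ * ⌊ g /2⌋ ≤ n
  helly-grid-size {u} {v} {w} {x} uv wx uw ux vw vx gap-uw gap-ux =
    pairs-injection⇒≤ vertex vertex-injective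
    where
    open RadiusGrid (Dist-triangle (Dist-sym uw) ux wx) (Dist-triangle uw wx ux)
      (Dist-triangle uw (Dist-sym vw) uv) (Dist-triangle (Dist-sym vw) vx wx)
      (Dist-triangle ux (Dist-sym vx) uv) gap-uw gap-ux

    GridVertex : Fin m → Fin m → Set
    GridVertex p q = ∃[ z ] (Dist G z u (uRadius (toℕ p) (toℕ q)) × Dist G z w (wRadius (toℕ p) (toℕ q)))

    grid-vertex : (p q : Fin m) → GridVertex p q
    grid-vertex p q =
      let i′ , j′ , i+i′≡a , j+j′≡b , c₂ , c₃ , c₄ = grid-radii (toℕ<n p) (toℕ<n q) in
      helly-four-balls helly {i = uRadius (toℕ p) (toℕ q)} {i′} {wRadius (toℕ p) (toℕ q)} {j′}
        (subst (Dist G u v) (sym i+i′≡a) uv) (subst (Dist G w x) (sym j+j′≡b) wx)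
        uw (grid-diagonal {toℕ p} (toℕ<n q)) ux c₂ vw c₃ vx c₄

    distinct : ∀ {p q p′ q′} (V : GridVertex p q) (V′ : GridVertex p′ q′) →
      proj₁ V ≡ proj₁ V′ → p ≡ p′ × q ≡ q′
    distinct {q = q} {q′ = q′} (z , dzu , dzw) (.z , dz′u , dz′w) refl =
      map toℕ-injective toℕ-injective
        (radii-injective (toℕ<n q) (toℕ<n q′) (Dist-unique dzu dz′u) (Dist-unique dzw dz′w))

    vertex : Fin m → Fin m → Fin n
    vertex p q = proj₁ (grid-vertex p q)

    vertex-injective : ∀ {p q p′ q′} → vertex p q ≡ vertex p′ q′ → p ≡ p′ × q ≡ q′
    vertex-injective {p} {q} {p′} {q′} = distinct (grid-vertex p q) (grid-vertex p′ q′)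

  helly-gap-bound : ∀ {u v w x a b duw dux dvw dvx g} →
    Dist G u v a → Dist G w x b → Dist G u w duw → Dist G u x dux → Dist G v w dvw → Dist G v x dvx →
    duw + dvx + g ≤ a + b → dux + dvw + g ≤ a + b → (g ∸ 2) * (g ∸ 2) ≤ 4 * n
  helly-gap-bound {g = g} uv wx uw ux vw vx gap-uw gap-ux = begin
    (g ∸ 2) * (g ∸ 2)                          ≤⟨ *-mono-≤ (n∸2≤⌊n/2⌋+⌊n/2⌋ g) (n∸2≤⌊n/2⌋+⌊n/2⌋ g) ⟩
    (⌊ g /2⌋ + ⌊ g /2⌋) * (⌊ g /2⌋ + ⌊ g /2⌋)  ≡⟨ double-square ⌊ g /2⌋ ⟩
    4 * (⌊ g /2⌋ * ⌊ g /2⌋)                    ≤⟨ *-monoʳ-≤ 4 (helly-grid-size uv wx uw ux vw vx gap-uw gap-ux) ⟩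
    4 * n                                      ∎
    where
    open ≤-Reasoning
    double-square : ∀ k → (k + k) * (k + k) ≡ 4 * (k * k)
    double-square = solve-∀

  helly-four-point-bound : ∀ {u v w x duv dwx duw dvx dux dvw} →
    Dist G u v duv → Dist G w x dwx → Dist G u w duw → Dist G v x dvx → Dist G u x dux → Dist G v w dvw →
    let g = gap (duv + dwx) (duw + dvx) (dux + dvw) in (g ∸ 2) * (g ∸ 2) ≤ 4 * n
  helly-four-point-bound {duv = duv} {dwx} {duw} {dvx} {dux} {dvw} uv wx uw vx ux vw
    with gap-cases (duv + dwx) (duw + dvx) (dux + dvw)
  ... | inj₁ (B+g≤A , C+g≤A) =
    helly-gap-bound uv wx uw ux vw vx B+g≤A C+g≤A
  ... | inj₂ (inj₁ (A+g≤B , C+g≤B)) =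
    helly-gap-bound uw vx uv ux (Dist-sym vw) wx A+g≤B C+g≤B
  ... | inj₂ (inj₂ (A+g≤C , B+g≤C)) =
    helly-gap-bound ux vw uv uw (Dist-sym vx) (Dist-sym wx) A+g≤C B+g≤C

  helly-fourPoint : ∀ t → 4 * n < (suc t ∸ 2) * (suc t ∸ 2) → FourPoint G t
  helly-fourPoint t 4n<bound _ _ _ _ _ _ _ _ _ _ uv wx uw vx ux vw = ≮⇒≥ λ t<g →
    <⇒≱ 4n<bound (≤-trans (*-mono-≤ (∸-monoˡ-≤ 2 t<g) (∸-monoˡ-≤ 2 t<g))
                          (helly-four-point-bound uv wx uw vx ux vw))

corollary2 : ∀ (n : ℕ) (G : Graph n) → Connected G → Helly G →
    ∀ (t : ℕ) → IsHyperbolicity G t → (t ∸ 2) * (t ∸ 2) ≤ 4 * n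
corollary2 n G _ helly zero    _            = z≤n
corollary2 n G _ helly (suc t) (_ , least) with (suc t ∸ 2) * (suc t ∸ 2) ≤? 4 * n
... | yes bound = bound
... | no ¬bound = contradiction (least t (helly-fourPoint helly t (≰⇒> ¬bound))) 1+n≰n
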